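{- Let $C$ be a super-Belnap calculus which contains both Identity and Limited Cut. Then Cut is a derivable rule in $C$: for all formulas $\varphi$ and finite multisets $\Gamma,\Gamma',\Delta,\Delta'$, the sequent $\Gamma,\Gamma'\vartriangleright\Delta,\Delta'$ is derivable in $C$ from $\{\Gamma\vartriangleright\Delta,\varphi,\ \varphi,\Gamma'\vartriangleright\Delta'\}$.
   Context: Formulas are built from atoms using $\wedge,\vee,{ - },\top,\bot$; a sequent $\Gamma\vartriangleright\Delta$ is a pair of finite multisets of formulas. The calculus $G\mathcal{B}$ consists of the introduction rules: from $\Gamma\vartriangleright\Delta,\varphi$ and $\Gamma\vartriangleright\Delta,\psi$ infer $\Gamma\vartriangleright\Delta,\varphi\wedge\psi$; from $\varphi,\psi,\Gamma\vartriangleright\Delta$ infer $\varphi\wedge\psi,\Gamma\vartriangleright\Delta$; from $\varphi,\Gamma\vartriangleright\Delta$ and $\psi,\Gamma\vartriangleright\Delta$ infer $\varphi\vee\psi,\Gamma\vartriangleright\Delta$; from $\Gamma\vartriangleright\Delta,\varphi,\psi$ infer $\Gamma\vartriangleright\Delta,\varphi\vee\psi$; from $\varphi,\Gamma\vartriangleright\Delta$ infer $\Gamma\vartriangleright\Delta,{ - }\varphi$; from $\Gamma\vartriangleright\Delta,\varphi$ infer ${ - }\varphi,\Gamma\vartriangleright\Delta$; axioms $\emptyset\vartriangleright\top$, $\bot\vartriangleright\emptyset$; the elimination rules, which are the inverses of all these two-way rules (e.g. from $\Gamma\vartriangleright\Delta,\varphi\wedge\psi$ infer each of $\Gamma\vartriangleright\Delta,\varphi$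 and $\Gamma\vartriangleright\Delta,\psi$), together with: from $\top,\Gamma\vartriangleright\Delta$ infer $\Gamma\vartriangleright\Delta$, and from $\Gamma\vartriangleright\Delta,\bot$ infer $\Gamma\vartriangleright\Delta$; and the structural rules Weakening and Contraction on both sides. A structural rule is a rule whose premises and conclusion are atomic sequents (sequents of atoms), applied in all substitution instances; rule schemata without connectives (with formula and multiset metavariables) are sets of such rules. A super-Belnap calculus is $G\mathcal{B}$ extended by a set of structural rules. Identity: the axiom $\varphi\vartriangleright\varphi$. Limited Cut: from $\emptyset\vartriangleright\varphi$ and $\varphi,\Gamma\vartriangleright\Delta$ infer $\Gamma\vartriangleright\Delta$, and from $\Gamma\vartriangleright\Delta,\varphi$ and $\varphi\vartriangleright\emptyset$ infer $\Gamma\vartriangleright\Delta$. -}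

module Defs where

open import Data.Nat using (ℕ)
open import Data.List using (List; []; _∷_; _++_; map)
open import Data.List.Relation.Unary.All using (All)
open import Data.List.Relation.Binary.Permutation.Propositional using (_↭_)
open import Data.Product using (_×_; _,_)
open import Data.Sum using (_⊎_)
open import Relation.Binary.PropositionalEquality using (_≡_)

Atom : Set
Atom = ℕ

infixr 6 _∧_
infixr 5 _∨_
data Fm : Set where
  atom : Atom → Fm
  _∧_  : Fm → Fm → Fm
  _∨_  : Fm → Fm → Fm
  -_   : Fm → Fm
  ⊤f   : Fm
  ⊥f   : Fm

-- Sequents: pairs of finite multisets, represented by lists;
-- the multiset reading is enforced by the exchange rule `exch` below.
infix 3 _▷_
data Seq : Set where
  _▷_ : List Fm → List Fm → Seq

ASeq : Set
ASeq = List Atom × List Atom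

record SRule : Set where
  constructor rule
  field
    prems  : List ASeq
    concl  : ASeq
open SRule public

inst : (Atom → Fm) → ASeq → Seq
inst σ (Γ , Δ) = map σ Γ ▷ map σ Δ

-- Derivability in the super-Belnap calculus GB + R
-- (R : a set of structural rules) from a set H of premise sequents.
-- Convention: "Γ ▷ Δ, φ" is written  Γ ▷ φ ∷ Δ  and "φ, Γ ▷ Δ" as φ ∷ Γ ▷ Δ.
data Der (R : SRule → Set) (H : Seq → Set) : Seq → Set where
  hyp   : ∀ {S} → H S → Der R H S
  exch  : ∀ {Γ Γ' Δ Δ'} → Γ ↭ Γ' → Δ ↭ Δ' → Der R H (Γ ▷ Δ) → Der R H (Γ' ▷ Δ')
  ∧R    : ∀ {Γ Δ φ ψ} → Der R H (Γ ▷ φ ∷ Δ) → Der R H (Γ ▷ ψ ∷ Δ) → Der R H (Γ ▷ (φ ∧ ψ) ∷ Δ)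
  ∧L    : ∀ {Γ Δ φ ψ} → Der R H (φ ∷ ψ ∷ Γ ▷ Δ) → Der R H ((φ ∧ ψ) ∷ Γ ▷ Δ)
  ∨L    : ∀ {Γ Δ φ ψ} → Der R H (φ ∷ Γ ▷ Δ) → Der R H (ψ ∷ Γ ▷ Δ) → Der R H ((φ ∨ ψ) ∷ Γ ▷ Δ)
  ∨R    : ∀ {Γ Δ φ ψ} → Der R H (Γ ▷ φ ∷ ψ ∷ Δ) → Der R H (Γ ▷ (φ ∨ ψ) ∷ Δ)
  -R    : ∀ {Γ Δ φ} → Der R H (φ ∷ Γ ▷ Δ) → Der R H (Γ ▷ (- φ) ∷ Δ)
  -L    : ∀ {Γ Δ φ} → Der R H (Γ ▷ φ ∷ Δ) → Der R H ((- φ) ∷ Γ ▷ Δ)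
  ⊤ax   : Der R H ([] ▷ ⊤f ∷ [])
  ⊥ax   : Der R H (⊥f ∷ [] ▷ [])
  ∧R-e₁ : ∀ {Γ Δ φ ψ} → Der R H (Γ ▷ (φ ∧ ψ) ∷ Δ) → Der R H (Γ ▷ φ ∷ Δ)
  ∧R-e₂ : ∀ {Γ Δ φ ψ} → Der R H (Γ ▷ (φ ∧ ψ) ∷ Δ) → Der R H (Γ ▷ ψ ∷ Δ)
  ∧L-e  : ∀ {Γ Δ φ ψ} → Der R H ((φ ∧ ψ) ∷ Γ ▷ Δ) → Der R H (φ ∷ ψ ∷ Γ ▷ Δ)
  ∨L-e₁ : ∀ {Γ Δ φ ψ} → Der R H ((φ ∨ ψ) ∷ Γ ▷ Δ) → Der R H (φ ∷ Γ ▷ Δ)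
  ∨L-e₂ : ∀ {Γ Δ φ ψ} → Der R H ((φ ∨ ψ) ∷ Γ ▷ Δ) → Der R H (ψ ∷ Γ ▷ Δ)
  ∨R-e  : ∀ {Γ Δ φ ψ} → Der R H (Γ ▷ (φ ∨ ψ) ∷ Δ) → Der R H (Γ ▷ φ ∷ ψ ∷ Δ)
  -R-e  : ∀ {Γ Δ φ} → Der R H (Γ ▷ (- φ) ∷ Δ) → Der R H (φ ∷ Γ ▷ Δ)
  -L-e  : ∀ {Γ Δ φ} → Der R H ((- φ) ∷ Γ ▷ Δ) → Der R H (Γ ▷ φ ∷ Δ)
  ⊤-e   : ∀ {Γ Δ} → Der R H (⊤f ∷ Γ ▷ Δ) → Der R H (Γ ▷ Δ)
  ⊥-e   : ∀ {Γ Δ} → Der R H (Γ ▷ ⊥f ∷ Δ) → Der R H (Γ ▷ Δ)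
  WL    : ∀ {Γ Δ φ} → Der R H (Γ ▷ Δ) → Der R H (φ ∷ Γ ▷ Δ)
  WR    : ∀ {Γ Δ φ} → Der R H (Γ ▷ Δ) → Der R H (Γ ▷ φ ∷ Δ)
  CL    : ∀ {Γ Δ φ} → Der R H (φ ∷ φ ∷ Γ ▷ Δ) → Der R H (φ ∷ Γ ▷ Δ)
  CR    : ∀ {Γ Δ φ} → Der R H (Γ ▷ φ ∷ φ ∷ Δ) → Der R H (Γ ▷ φ ∷ Δ)
  struct : (r : SRule) → R r → (σ : Atom → Fm) →
           All (λ s → Der R H (inst σ s)) (prems r) →
           Der R H (inst σ (concl r))

HasIdentity : (SRule → Set) → Set
HasIdentity R = ∀ (p : Atom) → R (rule [] (p ∷ [] , p ∷ []))

HasLimitedCut : (SRule → Set) → Set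
HasLimitedCut R =
  (∀ (p : Atom) (Γ Δ : List Atom) →
     R (rule (([] , p ∷ []) ∷ (p ∷ Γ , Δ) ∷ []) (Γ , Δ)))
  × (∀ (p : Atom) (Γ Δ : List Atom) →
     R (rule ((Γ , p ∷ Δ) ∷ (p ∷ [] , []) ∷ []) (Γ , Δ)))

CutPrems : Fm → List Fm → List Fm → List Fm → List Fm → Seq → Set
CutPrems φ Γ Γ' Δ Δ' S = (S ≡ (Γ ▷ φ ∷ Δ)) ⊎ (S ≡ (φ ∷ Γ' ▷ Δ'))

-- Limited Cut only cuts on a formula provable outright, and Identity makes the excluded middle
-- -φ ∨ φ provable. Cutting on -φ ∨ φ, ∨L reduces the goal to -φ,Γ,Γ' ▷ Δ,Δ' and φ,Γ,Γ' ▷ Δ,Δ',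
-- which are the two Cut premises up to weakening, exchange and the negation rule.
-- The structural rules are schemata over atomic sequents, so to apply them to arbitrary lists of
-- formulas we name every formula by its position in one list and substitute by lookup.
module Submission where

open import Defs
open import Data.Nat using (ℕ; zero; suc)
open import Data.List using (List; []; _∷_; _++_; map; length)
open import Data.List.Relation.Unary.All using ([]; _∷_)
open import Data.List.Relation.Binary.Permutation.Propositional using (↭-refl)
open import Data.List.Relation.Binary.Permutation.Propositional.Properties using (++-comm; shift)
open import Data.Product using (proj₁)
open import Data.Sum using (inj₁; inj₂)
open import Relation.Binary.PropositionalEquality using (_≡_; refl; sym; trans; cong; subst₂)

-- Out-of-range indices read ⊤f; they never occur below.
nth : List Fm → ℕ → Fm
nth []       _       = ⊤f
nth (x ∷ xs) zero    = x
nth (x ∷ xs) (suc n) = nth xs n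

positions : ℕ → List Fm → List Atom
positions k []       = []
positions k (x ∷ xs) = k ∷ positions (suc k) xs

map-nth-positions-suc : ∀ y L k xs →
  map (nth (y ∷ L)) (positions (suc k) xs) ≡ map (nth L) (positions k xs)
map-nth-positions-suc y L k []       = refl
map-nth-positions-suc y L k (x ∷ xs) = cong (nth L k ∷_) (map-nth-positions-suc y L (suc k) xs)

map-nth-positions : ∀ pre xs post → map (nth (pre ++ xs ++ post)) (positions (length pre) xs) ≡ xs
map-nth-positions []        []       post = refl
map-nth-positions []        (x ∷ xs) post =
  cong (x ∷_) (trans (map-nth-positions-suc x (xs ++ post) 0 xs) (map-nth-positions [] xs post))
map-nth-positions (y ∷ pre) xs post =
  trans (map-nth-positions-suc y (pre ++ xs ++ post) (length pre) xs) (map-nth-positions pre xs post)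

module _ {R : SRule → Set} {H : Seq → Set} where

  identity : HasIdentity R → ∀ φ → Der R H (φ ∷ [] ▷ φ ∷ [])
  identity hasId φ = struct _ (hasId 0) (λ _ → φ) []

  limited-cutˡ : HasLimitedCut R → ∀ χ Γ Δ →
    Der R H ([] ▷ χ ∷ []) → Der R H (χ ∷ Γ ▷ Δ) → Der R H (Γ ▷ Δ)
  limited-cutˡ hasCut χ Γ Δ ⊢χ χΓ⊢Δ =
    subst₂ (λ A B → Der R H (A ▷ B)) Γ-inst Δ-inst
      (struct _ (proj₁ hasCut 0 Γ-atoms Δ-atoms) σ
        (⊢χ ∷ subst₂ (λ A B → Der R H (χ ∷ A ▷ B)) (sym Γ-inst) (sym Δ-inst) χΓ⊢Δ ∷ []))
    where
    σ : Atom → Fm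
    σ = nth ((χ ∷ Γ) ++ Δ ++ [])
    Γ-atoms Δ-atoms : List Atom
    Γ-atoms = positions 1 Γ
    Δ-atoms = positions (suc (length Γ)) Δ
    Γ-inst : map σ Γ-atoms ≡ Γ
    Γ-inst = map-nth-positions (χ ∷ []) Γ (Δ ++ [])
    Δ-inst : map σ Δ-atoms ≡ Δ
    Δ-inst = map-nth-positions (χ ∷ Γ) Δ []

  weakenˡ : ∀ Γ' {Γ Δ} → Der R H (Γ ▷ Δ) → Der R H (Γ' ++ Γ ▷ Δ)
  weakenˡ []       d = d
  weakenˡ (x ∷ xs) d = WL (weakenˡ xs d)

  weakenʳ : ∀ Δ' {Γ Δ} → Der R H (Γ ▷ Δ) → Der R H (Γ ▷ Δ' ++ Δ)
  weakenʳ []       d = d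
  weakenʳ (x ∷ xs) d = WR (weakenʳ xs d)

  excluded-middle : HasIdentity R → ∀ φ → Der R H ([] ▷ ((- φ) ∨ φ) ∷ [])
  excluded-middle hasId φ = ∨R (-R (identity hasId φ))

proposition3p4 : (R : SRule → Set) → HasIdentity R → HasLimitedCut R →
    (φ : Fm) (Γ Γ' Δ Δ' : List Fm) →
    Der R (CutPrems φ Γ Γ' Δ Δ') (Γ ++ Γ' ▷ Δ ++ Δ')
proposition3p4 R hasId hasCut φ Γ Γ' Δ Δ' =
  limited-cutˡ hasCut ((- φ) ∨ φ) (Γ ++ Γ') (Δ ++ Δ')
    (excluded-middle hasId φ) (∨L from-left-premise from-right-premise)
  where
  from-left-premise : Der R (CutPrems φ Γ Γ' Δ Δ') ((- φ) ∷ Γ ++ Γ' ▷ Δ ++ Δ')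
  from-left-premise =
    -L (exch (++-comm Γ' Γ) (++-comm Δ' (φ ∷ Δ)) (weakenˡ Γ' (weakenʳ Δ' (hyp (inj₁ refl)))))
  from-right-premise : Der R (CutPrems φ Γ Γ' Δ Δ') (φ ∷ Γ ++ Γ' ▷ Δ ++ Δ')
  from-right-premise = exch (shift φ Γ Γ') ↭-refl (weakenˡ Γ (weakenʳ Δ (hyp (inj₂ refl))))
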